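{- Let $k$ be a positive integer. If $G$ is a graph of order $n$ with minimum degree at least $k$ and with no induced subgraph isomorphic to $K_{1,k+1}$, then $\Psi_g^+(G) \ge \frac{1}{2}n$ and $\Psi_g^-(G) \ge \frac{1}{2}n$.
   Context: For a set $S$ of vertices of a graph $G$, a vertex $v \in S$ is an enclave of $S$ if $N[v] \subseteq S$; $S$ is enclaveless if it contains no enclave. The competition-enclaveless game on $G$ is played by Maximizer and Minimizer, who alternately choose a vertex $v$ not in the set $S$ of previously chosen vertices such that $S\cup\{v\}$ is enclaveless; the game ends when no such vertex exists. Maximizer aims to maximize and Minimizer to minimize the final $|S|$. $\Psi_g^+(G)$ is the final $|S|$ when Maximizer moves first and both play optimally; $\Psi_g^-(G)$ is the same when Minimizer moves first. -}

module Defs where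

open import Data.Bool using (Bool; true; false; _∧_; _∨_; not; if_then_else_)
open import Data.Nat using (ℕ; zero; suc; _⊔_; _⊓_; _≤_)
open import Data.Fin using (Fin)
open import Data.Fin.Subset using (Subset; ⁅_⁆; _∪_; ∣_∣)
open import Data.Vec using (lookup)
open import Data.List using (List; []; _∷_; filter; map; foldr; allFin; length)
open import Data.Bool.ListAction using (all; any)
open import Data.Product using (Σ; _×_)
open import Function.Definitions using (Injective)
open import Relation.Binary.PropositionalEquality using (_≡_)
open import Relation.Nullary.Decidable using (T?)

record Graph (n : ℕ) : Set where
  field
    adj   : Fin n → Fin n → Bool
    sym   : ∀ u v → adj u v ≡ adj v u
    irrefl : ∀ v → adj v v ≡ false
open Graph public

degree : ∀ {n} → Graph n → Fin n → ℕ
degree G v = length (filter (λ w → T? (adj G v w)) (allFin _))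

MinDegreeAtLeast : ∀ {n} → Graph n → ℕ → Set
MinDegreeAtLeast G k = ∀ v → k ≤ degree G v

-- G has an induced subgraph isomorphic to K_{1,m}: a centre c and m distinct
-- leaves, all adjacent to c and pairwise non-adjacent (leaves ≠ c follows
-- from irreflexivity).
HasInducedStar : ∀ {n} → Graph n → ℕ → Set
HasInducedStar {n} G m =
  Σ (Fin n) λ c → Σ (Fin m → Fin n) λ f →
    Injective _≡_ _≡_ f ×
    (∀ i → adj G c (f i) ≡ true) ×
    (∀ i j → adj G (f i) (f j) ≡ false)

isEnclave : ∀ {n} → Graph n → Subset n → Fin n → Bool
isEnclave G S v =
  lookup S v ∧ all (λ w → not (adj G v w) ∨ lookup S w) (allFin _)

enclaveless : ∀ {n} → Graph n → Subset n → Bool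
enclaveless G S = not (any (isEnclave G S) (allFin _))

legal : ∀ {n} → Graph n → Subset n → Fin n → Bool
legal G S v = not (lookup S v) ∧ enclaveless G (S ∪ ⁅ v ⁆)

legalMoves : ∀ {n} → Graph n → Subset n → List (Fin n)
legalMoves G S = filter (λ v → T? (legal G S v)) (allFin _)

data Player : Set where
  Maximizer Minimizer : Player

other : Player → Player
other Maximizer = Minimizer
other Minimizer = Maximizer

-- optimal final size of the game from position S with player p to move;
-- the fuel bounds the number of remaining moves (each move adds a new
-- vertex, so fuel n always suffices).
value : ∀ {n} → Graph n → ℕ → Player → Subset n → ℕ
value G zero p S = ∣ S ∣
value G (suc f) p S with legalMoves G S
... | [] = ∣ S ∣
... | v ∷ vs with p
...   | Maximizer = foldr _⊔_ (value G f Minimizer (S ∪ ⁅ v ⁆))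
                      (map (λ w → value G f Minimizer (S ∪ ⁅ w ⁆)) vs)
...   | Minimizer = foldr _⊓_ (value G f Maximizer (S ∪ ⁅ v ⁆))
                      (map (λ w → value G f Maximizer (S ∪ ⁅ w ⁆)) vs)

open import Data.Fin.Subset using (⊥)

Ψg⁺ : ∀ {n} → Graph n → ℕ
Ψg⁺ {n} G = value G n Maximizer ⊥

Ψg⁻ : ∀ {n} → Graph n → ℕ
Ψg⁻ {n} G = value G n Minimizer ⊥

-- Every play ends in an enclaveless set S to which no vertex can be added, and the
-- game value is the size of one such S, so it suffices to show n ≤ 2 ∣S∣ for them.
-- For u ∉ S, adding u creates an enclave: either u itself, so N(u) ⊆ S, or some
-- w ∈ S whose only neighbour outside S is u ("w is private to u").  Weight the
-- edges uw with u ∉ S, w ∈ S by k if w is private to u, and otherwise by 1 if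
-- N(u) ⊆ S.  Each u ∉ S then has weight at least k, by the degree bound.  Each
-- w ∈ S has weight at most k: a private w carries weight only from its owner,
-- and otherwise the u contributing to w form an independent set of neighbours
-- of w, of size at most k as G has no induced K_{1,k+1}.  Hence
-- k ∣V ∖ S∣ ≤ k ∣S∣.
module Submission where

open import Defs hiding (sym)
open import Data.Bool using (true; false; T; not; _∨_; if_then_else_)
open import Data.Bool.Properties using (T-≡; T-not-≡; T-∧)
open import Data.Empty using (⊥-elim)
open import Data.Fin using (Fin; zero; suc; punchIn)
open import Data.Fin.Properties using (punchInᵢ≢i; suc-injective; all?; any?)
open import Data.Fin.Subset using (Subset; ∣_∣; _∈_; _∉_; _⊂_; _∪_; ⁅_⁆; ∁; ⊥)
open import Data.Fin.Subset.Properties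
  using (_∈?_; x∈p∪q⁻; x∈p∪q⁺; x∈⁅x⁆; x∈⁅y⁆⇒x≡y; x∈∁p⇒x∉p; p⊆p∪q; p⊂q⇒∣p∣<∣q∣;
         ∣p∣≤n; ∣p∣≡n⇒p≡⊤; ∈⊤; ∉⊥; ∣∁p∣≡n∸∣p∣)
open import Data.List using ([]; _∷_; length; filter; tabulate; allFin; foldr; map)
open import Data.List.Membership.Propositional using () renaming (_∈_ to _∈ₗ_)
open import Data.List.Membership.Propositional.Properties
  using (∈-filter⁺; ∈-filter⁻; ∈-allFin; foldr-selective; ∈-map⁻)
open import Data.List.Relation.Unary.Any using (here; there)
import Data.List.Relation.Unary.All.Properties as All
import Data.List.Relation.Unary.Any.Properties as Any
open import Data.Nat using (ℕ; zero; suc; _+_; _*_; _∸_; _≤_; z≤n; s≤s⁻¹; >-nonZero)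
open import Data.Nat.Properties
  using (≤-refl; ≤-trans; ≤-reflexive; ≤-antisym; ≮⇒≥; +-mono-≤; +-monoʳ-≤; +-monoˡ-≤; +-suc;
         +-identityʳ; m≤m+n; m≤n+m; m≤n+m∸n; *-identityʳ; *-zeroʳ; *-cancelˡ-≤; ⊔-sel; ⊓-sel;
         +-*-semiring; module ≤-Reasoning)
open import Data.Product using (∃; _×_; _,_; proj₁; proj₂)
open import Data.Sum using (_⊎_; inj₁; inj₂; [_,_]′)
import Data.Sum as Sum
open import Data.Vec using (_∷_; []; lookup)
open import Data.Vec.Properties using ([]=⇒lookup; lookup⇒[]=)
open import Algebra.Definitions using (Selective)
open import Algebra.Core using (Op₂)
open import Function using (_∘_; _⇔_; mk⇔; Equivalence; case_of_)
open import Function.Definitions using (Injective)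
open import Relation.Binary.PropositionalEquality
  using (_≡_; _≢_; _≗_; refl; sym; trans; cong; subst; module ≡-Reasoning)
open import Relation.Nullary using (Dec; yes; no; does; ¬_; ¬?; _×-dec_; _→-dec_)
open import Relation.Nullary.Decidable using (dec-true; dec-false; decidable-stable; T?)
open import Relation.Unary using (Pred; Decidable)
open import Algebra.Properties.Semiring.Sum +-*-semiring
  using (sum; sum-syntax; ∑-comm; sum-remove; sum-cong-≗; sum-replicate-zero; *-distribˡ-sum)

open Equivalence using (to; from)

𝟙 : ∀ {a} {A : Set a} → Dec A → ℕ
𝟙 a? = if does a? then 1 else 0

𝟙-≤ : ∀ {a} {A : Set a} (a? : Dec A) {x} → (A → 1 ≤ x) → 𝟙 a? ≤ x
𝟙-≤ (yes a) 1≤x = 1≤x a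
𝟙-≤ (no _)  _   = z≤n

*𝟙-≤ : ∀ {a} {A : Set a} (a? : Dec A) {k x} → (A → k ≤ x) → k * 𝟙 a? ≤ x
*𝟙-≤ (yes a) {k} k≤x = ≤-trans (≤-reflexive (*-identityʳ k)) (k≤x a)
*𝟙-≤ (no _)  {k} _   = ≤-trans (≤-reflexive (*-zeroʳ k)) z≤n

≤-*𝟙 : ∀ {a} {A : Set a} (a? : Dec A) {k x} → (A → x ≤ k) → (¬ A → x ≡ 0) → x ≤ k * 𝟙 a?
≤-*𝟙 (yes a)  {k} x≤k _   = ≤-trans (x≤k a) (≤-reflexive (sym (*-identityʳ k)))
≤-*𝟙 (no ¬a)      _   x≡0 = ≤-trans (≤-reflexive (x≡0 ¬a)) z≤n

∑-mono-≤ : ∀ {n} {f g : Fin n → ℕ} → (∀ i → f i ≤ g i) → sum f ≤ sum g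
∑-mono-≤ {zero}  f≤g = z≤n
∑-mono-≤ {suc n} f≤g = +-mono-≤ (f≤g zero) (∑-mono-≤ (f≤g ∘ suc))

≤-∑ : ∀ {n} (f : Fin n → ℕ) i → f i ≤ sum f
≤-∑ {suc n} f i = ≤-trans (m≤m+n (f i) _) (≤-reflexive (sym (sum-remove f)))

∑-concentrated : ∀ {n} (f : Fin n → ℕ) i → (∀ j → j ≢ i → f j ≡ 0) → sum f ≡ f i
∑-concentrated {suc n} f i f≡0 = begin
  sum f                             ≡⟨ sum-remove f ⟩
  f i + sum (λ j → f (punchIn i j)) ≡⟨ cong (f i +_) (sum-cong-≗ λ j → f≡0 _ (punchInᵢ≢i i j)) ⟩
  f i + sum {n} (λ _ → 0)           ≡⟨ cong (f i +_) (sum-replicate-zero n) ⟩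
  f i + 0                           ≡⟨ +-identityʳ (f i) ⟩
  f i                               ∎
  where open ≡-Reasoning

double-counting : ∀ {m n} (c : Fin m → Fin n → ℕ) (r : Fin m → ℕ) (s : Fin n → ℕ) →
                  (∀ i → r i ≤ ∑[ j < n ] c i j) → (∀ j → ∑[ i < m ] c i j ≤ s j) →
                  sum r ≤ sum s
double-counting {m} {n} c r s rows cols = begin
  sum r                      ≤⟨ ∑-mono-≤ rows ⟩
  ∑[ i < m ] ∑[ j < n ] c i j ≡⟨ ∑-comm c ⟩
  ∑[ j < n ] ∑[ i < m ] c i j ≤⟨ ∑-mono-≤ cols ⟩
  sum s                      ∎
  where open ≤-Reasoning

∣p∣≡∑𝟙 : ∀ {n} (p : Subset n) → ∣ p ∣ ≡ ∑[ i < n ] 𝟙 (i ∈? p)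
∣p∣≡∑𝟙 []            = refl
∣p∣≡∑𝟙 (true  ∷ p) = cong suc (∣p∣≡∑𝟙 p)
∣p∣≡∑𝟙 (false ∷ p) = ∣p∣≡∑𝟙 p

length-filter≡∑𝟙 : ∀ {a p n} {A : Set a} {P : Pred A p} (P? : Decidable P) (f : Fin n → A) →
                   length (filter P? (tabulate f)) ≡ ∑[ i < n ] 𝟙 (P? (f i))
length-filter≡∑𝟙 {n = zero}  P? f = refl
length-filter≡∑𝟙 {n = suc n} P? f with P? (f zero)
... | yes _ = cong suc (length-filter≡∑𝟙 P? (f ∘ suc))
... | no  _ = length-filter≡∑𝟙 P? (f ∘ suc)

∑𝟙⇒injection : ∀ {p m n} {P : Pred (Fin n) p} (P? : Decidable P) → m ≤ ∑[ i < n ] 𝟙 (P? i) →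
               ∃ λ (g : Fin m → Fin n) → Injective _≡_ _≡_ g × (∀ i → P (g i))
∑𝟙⇒injection {m = zero} P? _ = (λ ()) , (λ { {()} }) , (λ ())
∑𝟙⇒injection {m = suc m} {n = suc n} P? m≤∑ with P? zero
... | no _ = let g , g-inj , Pg = ∑𝟙⇒injection (λ i → P? (suc i)) m≤∑ in
  (λ i → suc (g i)) , (λ e → g-inj (suc-injective e)) , Pg
... | yes P0 = let g , g-inj , Pg = ∑𝟙⇒injection (λ i → P? (suc i)) (s≤s⁻¹ m≤∑) in
  (λ { zero → zero ; (suc i) → suc (g i) }) ,
  (λ { {zero} {zero} _ → refl ; {suc _} {suc _} e → cong suc (g-inj (suc-injective e)) }) ,
  (λ { zero → P0 ; (suc i) → Pg i })

T-lookup⇔∈ : ∀ {n} {S : Subset n} {v} → T (lookup S v) ⇔ v ∈ S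
T-lookup⇔∈ {S = S} {v} =
  mk⇔ (λ t → lookup⇒[]= v S (T-≡ .to t)) (λ v∈S → T-≡ .from ([]=⇒lookup v∈S))

T-not⇔¬T : ∀ {b} → T (not b) ⇔ (¬ T b)
T-not⇔¬T {true}  = mk⇔ (λ ()) (λ ¬t → ¬t _)
T-not⇔¬T {false} = mk⇔ (λ _ ()) (λ _ → _)

T-not-∨⇔⇒ : ∀ {a b} → T (not a ∨ b) ⇔ (T a → T b)
T-not-∨⇔⇒ {true}  = mk⇔ (λ tb _ → tb) (λ f → f _)
T-not-∨⇔⇒ {false} = mk⇔ (λ _ ()) (λ _ → _)

∈-∪⁅⁆⁻ : ∀ {n} {S : Subset n} {u x} → x ∈ S ∪ ⁅ u ⁆ → x ∈ S ⊎ x ≡ u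
∈-∪⁅⁆⁻ {S = S} {u} = Sum.map₂ (x∈⁅y⁆⇒x≡y u) ∘ x∈p∪q⁻ S ⁅ u ⁆

module _ {n} (G : Graph n) where

  adj-sym : ∀ {u v} → T (adj G u v) → T (adj G v u)
  adj-sym {u} {v} = subst T (Graph.sym G u v)

  adj-irrefl : ∀ {v} → ¬ T (adj G v v)
  adj-irrefl {v} = subst T (irrefl G v)

  NeighboursIn : Subset n → Fin n → Set
  NeighboursIn S v = ∀ w → T (adj G v w) → w ∈ S

  neighboursIn? : ∀ S → Decidable (NeighboursIn S)
  neighboursIn? S v = all? λ w → T? (adj G v w) →-dec (w ∈? S)

  neighboursIn-∪⁅⁆ : ∀ {S u w} → NeighboursIn (S ∪ ⁅ u ⁆) w → ¬ T (adj G w u) → NeighboursIn S w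
  neighboursIn-∪⁅⁆ N ¬w~u x w~x with ∈-∪⁅⁆⁻ (N x w~x)
  ... | inj₁ x∈S = x∈S
  ... | inj₂ refl = ⊥-elim (¬w~u w~x)

  Enclave : Subset n → Fin n → Set
  Enclave S v = v ∈ S × NeighboursIn S v

  T-isEnclave⇔Enclave : ∀ {S v} → T (isEnclave G S v) ⇔ Enclave S v
  T-isEnclave⇔Enclave {S} {v} = mk⇔
    (λ t → let inS , nbrs = T-∧ .to t in
       T-lookup⇔∈ .to inS ,
       λ w v~w → T-lookup⇔∈ .to (T-not-∨⇔⇒ .to (All.tabulate⁻ (All.all⁺ _ (allFin n) nbrs) w) v~w))
    (λ (v∈S , N) → T-∧ .from (T-lookup⇔∈ .from v∈S ,
       All.all⁻ _ (All.tabulate⁺ λ w → T-not-∨⇔⇒ .from (T-lookup⇔∈ .from ∘ N w))))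

  T-enclaveless⇔noEnclave : ∀ {S} → T (enclaveless G S) ⇔ (∀ v → ¬ Enclave S v)
  T-enclaveless⇔noEnclave {S} = mk⇔
    (λ t v e → T-not⇔¬T .to t (Any.any⁺ _ (Any.tabulate⁺ v (T-isEnclave⇔Enclave .from e))))
    (λ none → T-not⇔¬T .from λ t →
       let v , e = Any.tabulate⁻ (Any.any⁻ _ (allFin n) t) in none v (T-isEnclave⇔Enclave .to e))

  ¬enclaveless⇒enclave : ∀ {S} → ¬ T (enclaveless G S) → ∃ (Enclave S)
  ¬enclaveless⇒enclave {S} ¬t =
    let v , e = Any.tabulate⁻ (Any.any⁻ _ (allFin n) (decidable-stable (T? _) (¬t ∘ T-not⇔¬T .from)))
    in v , T-isEnclave⇔Enclave .to e

  legal⇒ : ∀ {S v} → T (legal G S v) → v ∉ S × T (enclaveless G (S ∪ ⁅ v ⁆))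
  legal⇒ t = let outside , encl = T-∧ .to t in T-not⇔¬T .to outside ∘ T-lookup⇔∈ .from , encl

  ¬legal⇒enclave : ∀ {S v} → v ∉ S → ¬ T (legal G S v) → ∃ (Enclave (S ∪ ⁅ v ⁆))
  ¬legal⇒enclave v∉S ¬legal = ¬enclaveless⇒enclave λ encl →
    ¬legal (T-∧ .from (T-not⇔¬T .from (v∉S ∘ T-lookup⇔∈ .to) , encl))

  Terminal : Subset n → Set
  Terminal S = ∀ v → ¬ T (legal G S v)

  MaximalEnclaveless : Subset n → Set
  MaximalEnclaveless S = T (enclaveless G S) × Terminal S

  maximal⇒neighboursIn⊎private : ∀ {S u} → MaximalEnclaveless S → u ∉ S →
    NeighboursIn S u ⊎ ∃ λ w → w ∈ S × T (adj G u w) × NeighboursIn (S ∪ ⁅ u ⁆) w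
  maximal⇒neighboursIn⊎private {S} {u} (encl , term) u∉S with ¬legal⇒enclave u∉S (term u)
  ... | w , w∈S∪u , Nw with ∈-∪⁅⁆⁻ w∈S∪u
  ...   | inj₂ refl = inj₁ (neighboursIn-∪⁅⁆ Nw adj-irrefl)
  ...   | inj₁ w∈S with T? (adj G u w)
  ...     | yes u~w = inj₂ (w , w∈S , u~w , Nw)
  ...     | no ¬u~w = ⊥-elim (T-enclaveless⇔noEnclave .to encl w
                                (w∈S , neighboursIn-∪⁅⁆ Nw (¬u~w ∘ adj-sym)))

  starFree⇒independentNeighbours≤ : ∀ {k p} {P : Pred (Fin n) p} (P? : Decidable P) c →
    ¬ HasInducedStar G (suc k) →
    (∀ {u} → P u → T (adj G c u)) → (∀ {u v} → P u → P v → ¬ T (adj G u v)) →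
    ∑[ u < n ] 𝟙 (P? u) ≤ k
  starFree⇒independentNeighbours≤ {k} P? c noStar centre independent = ≮⇒≥ λ k<∑ →
    let g , g-inj , Pg = ∑𝟙⇒injection P? k<∑ in
    noStar (c , g , g-inj , (λ i → T-≡ .to (centre (Pg i))) ,
            λ i j → T-not-≡ .to (T-not⇔¬T .from (independent (Pg i) (Pg j))))

module Weighting {n} (G : Graph n) (S : Subset n) (k : ℕ) where

  Crossing : Fin n → Fin n → Set
  Crossing u w = u ∉ S × w ∈ S × T (adj G u w)

  crossing? : ∀ u w → Dec (Crossing u w)
  crossing? u w = ¬? (u ∈? S) ×-dec w ∈? S ×-dec T? (adj G u w)

  Private : Fin n → Fin n → Set
  Private u w = NeighboursIn G (S ∪ ⁅ u ⁆) w

  private? : ∀ u w → Dec (Private u w)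
  private? u = neighboursIn? G (S ∪ ⁅ u ⁆)

  weight : Fin n → Fin n → ℕ
  weight u w =
    if does (crossing? u w)
    then (if does (private? u w) then k else 𝟙 (neighboursIn? G S u))
    else 0

  -- `does` of crossing? and private? reduces to a boolean expression, so `with` cannot
  -- abstract these decisions in goals; the lemmas below rewrite with dec-true/dec-false.
  weight-private : ∀ {u w} → Crossing u w → Private u w → weight u w ≡ k
  weight-private {u} {w} c p rewrite dec-true (crossing? u w) c | dec-true (private? u w) p = refl

  weight-noncrossing : ∀ {u w} → ¬ Crossing u w → weight u w ≡ 0
  weight-noncrossing {u} {w} ¬c rewrite dec-false (crossing? u w) ¬c = refl

  weight-neighboursIn : ∀ {u w} → 1 ≤ k → Crossing u w → NeighboursIn G S u → 1 ≤ weight u w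
  weight-neighboursIn {u} {w} 1≤k c N rewrite dec-true (crossing? u w) c with private? u w
  ... | yes p rewrite dec-true (private? u w) p = 1≤k
  ... | no ¬p rewrite dec-false (private? u w) ¬p | dec-true (neighboursIn? G S u) N = ≤-refl

  weight-nonprivate : ∀ {u w} → ¬ (Crossing u w × Private u w) →
                      weight u w ≤ 𝟙 (crossing? u w ×-dec neighboursIn? G S u)
  weight-nonprivate {u} {w} ¬cp with crossing? u w
  ... | no ¬c rewrite dec-false (crossing? u w) ¬c = z≤n
  ... | yes c rewrite dec-true (crossing? u w) c | dec-false (private? u w) (¬cp ∘ (c ,_)) = ≤-refl

  k≤outgoingWeight : 1 ≤ k → MinDegreeAtLeast G k → MaximalEnclaveless G S →
                     ∀ u → u ∉ S → k ≤ ∑[ w < n ] weight u w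
  k≤outgoingWeight 1≤k δ≥k maximal u u∉S with maximal⇒neighboursIn⊎private G maximal u∉S
  ... | inj₂ (w , w∈S , u~w , p) =
    subst (_≤ _) (weight-private (u∉S , w∈S , u~w) p) (≤-∑ (weight u) w)
  ... | inj₁ N = begin
    k                                ≤⟨ δ≥k u ⟩
    degree G u                       ≡⟨ length-filter≡∑𝟙 (λ w → T? (adj G u w)) (λ w → w) ⟩
    ∑[ w < n ] 𝟙 (T? (adj G u w))    ≤⟨ ∑-mono-≤ adjacent≤weight ⟩
    ∑[ w < n ] weight u w            ∎
    where
    open ≤-Reasoning
    adjacent≤weight : ∀ w → 𝟙 (T? (adj G u w)) ≤ weight u w
    adjacent≤weight w = 𝟙-≤ (T? (adj G u w)) λ u~w →
      weight-neighboursIn 1≤k (u∉S , N w u~w , u~w) N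

  incomingWeight≤k : ¬ HasInducedStar G (suc k) → ∀ w → w ∈ S → ∑[ u < n ] weight u w ≤ k
  incomingWeight≤k noStar w w∈S with any? (λ u → crossing? u w ×-dec private? u w)
  ... | yes (u₀ , c₀ , p₀) =
    ≤-reflexive (trans (∑-concentrated (λ u → weight u w) u₀ onlyAt-u₀) (weight-private c₀ p₀))
    where
    onlyAt-u₀ : ∀ u → u ≢ u₀ → weight u w ≡ 0
    onlyAt-u₀ u u≢u₀ = weight-noncrossing λ (u∉S , _ , u~w) →
      [ ⊥-elim ∘ u∉S , u≢u₀ ]′ (∈-∪⁅⁆⁻ (p₀ u (adj-sym G u~w)))
  ... | no ¬private = begin
    ∑[ u < n ] weight u w               ≤⟨ ∑-mono-≤ (λ u → weight-nonprivate (λ cp → ¬private (u , cp))) ⟩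
    ∑[ u < n ] 𝟙 (closedCrossing? u)    ≤⟨ starFree⇒independentNeighbours≤ G closedCrossing? w noStar
                                             (λ ((_ , _ , u~w) , _) → adj-sym G u~w)
                                             (λ (_ , Nu) ((v∉S , _) , _) u~v → v∉S (Nu _ u~v)) ⟩
    k                                   ∎
    where
    open ≤-Reasoning
    closedCrossing? : ∀ u → Dec (Crossing u w × NeighboursIn G S u)
    closedCrossing? u = crossing? u w ×-dec neighboursIn? G S u

  incomingWeight-outside≡0 : ∀ w → w ∉ S → ∑[ u < n ] weight u w ≡ 0
  incomingWeight-outside≡0 w w∉S = trans (sum-cong-≗ noWeight) (sum-replicate-zero n)
    where
    noWeight : (λ u → weight u w) ≗ (λ _ → 0)
    noWeight u = weight-noncrossing {u} λ (_ , w∈S , _) → w∉S w∈S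

  k*∣∁S∣≤k*∣S∣ : 1 ≤ k → MinDegreeAtLeast G k → ¬ HasInducedStar G (suc k) →
                 MaximalEnclaveless G S → k * ∣ ∁ S ∣ ≤ k * ∣ S ∣
  k*∣∁S∣≤k*∣S∣ 1≤k δ≥k noStar maximal = begin
    k * ∣ ∁ S ∣                   ≡⟨ cong (k *_) (∣p∣≡∑𝟙 (∁ S)) ⟩
    k * ∑[ u < n ] 𝟙 (u ∈? ∁ S)   ≡⟨ *-distribˡ-sum k (λ u → 𝟙 (u ∈? ∁ S)) ⟩
    ∑[ u < n ] (k * 𝟙 (u ∈? ∁ S)) ≤⟨ double-counting weight _ _ rows columns ⟩
    ∑[ w < n ] (k * 𝟙 (w ∈? S))   ≡⟨ *-distribˡ-sum k (λ w → 𝟙 (w ∈? S)) ⟨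
    k * ∑[ w < n ] 𝟙 (w ∈? S)     ≡⟨ cong (k *_) (∣p∣≡∑𝟙 S) ⟨
    k * ∣ S ∣                     ∎
    where
    open ≤-Reasoning
    rows : ∀ u → k * 𝟙 (u ∈? ∁ S) ≤ ∑[ w < n ] weight u w
    rows u = *𝟙-≤ (u ∈? ∁ S) (k≤outgoingWeight 1≤k δ≥k maximal u ∘ x∈∁p⇒x∉p)
    columns : ∀ w → ∑[ u < n ] weight u w ≤ k * 𝟙 (w ∈? S)
    columns w = ≤-*𝟙 (w ∈? S) (incomingWeight≤k noStar w) (incomingWeight-outside≡0 w)

maximalEnclaveless⇒n≤2∣S∣ : ∀ {n k} (G : Graph n) {S : Subset n} → 1 ≤ k → MinDegreeAtLeast G k →
  ¬ HasInducedStar G (suc k) → MaximalEnclaveless G S → n ≤ 2 * ∣ S ∣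
maximalEnclaveless⇒n≤2∣S∣ {n} {k} G {S} 1≤k δ≥k noStar maximal = begin
  n                      ≤⟨ m≤n+m∸n n ∣ S ∣ ⟩
  ∣ S ∣ + (n ∸ ∣ S ∣)     ≡⟨ cong (∣ S ∣ +_) (∣∁p∣≡n∸∣p∣ S) ⟨
  ∣ S ∣ + ∣ ∁ S ∣         ≤⟨ +-monoʳ-≤ ∣ S ∣ (*-cancelˡ-≤ k {{>-nonZero 1≤k}} weighted) ⟩
  ∣ S ∣ + ∣ S ∣           ≡⟨ cong (∣ S ∣ +_) (+-identityʳ ∣ S ∣) ⟨
  2 * ∣ S ∣               ∎
  where
  open ≤-Reasoning
  weighted = Weighting.k*∣∁S∣≤k*∣S∣ G S k 1≤k δ≥k noStar maximal

foldr-selective-preserves : ∀ {a p} {A : Set a} {P : ℕ → Set p} {_•_ : Op₂ ℕ} → Selective _≡_ _•_ →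
                 (g : A → ℕ) → ∀ v vs → (∀ w → w ∈ₗ v ∷ vs → P (g w)) →
                 P (foldr _•_ (g v) (map g vs))
foldr-selective-preserves {P = P} sel g v vs Pg with foldr-selective sel (g v) (map g vs)
... | inj₁ fold≡gv = subst P (sym fold≡gv) (Pg v (here refl))
... | inj₂ fold∈   = let w , w∈vs , fold≡gw = ∈-map⁻ g fold∈ in subst P (sym fold≡gw) (Pg w (there w∈vs))

module _ {n} (G : Graph n) where

  Attained : ℕ → Set
  Attained x = ∃ λ S → MaximalEnclaveless G S × x ≡ ∣ S ∣

  legalMoves⁻ : ∀ {S v} → v ∈ₗ legalMoves G S → T (legal G S v)
  legalMoves⁻ {S} v∈ = proj₂ (∈-filter⁻ (λ v → T? (legal G S v)) {xs = allFin n} v∈)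

  legalMoves⁺ : ∀ {S v} → T (legal G S v) → v ∈ₗ legalMoves G S
  legalMoves⁺ {S} {v} t = ∈-filter⁺ (λ v → T? (legal G S v)) (∈-allFin v) t

  full⇒terminal : ∀ {S} → n ≤ ∣ S ∣ → Terminal G S
  full⇒terminal {S} n≤∣S∣ v t =
    proj₁ (legal⇒ G {S} t) (subst (v ∈_) (sym (∣p∣≡n⇒p≡⊤ (≤-antisym (∣p∣≤n S) n≤∣S∣))) ∈⊤)

  legal-step : ∀ {S v f} → n ≤ ∣ S ∣ + suc f → T (legal G S v) →
               T (enclaveless G (S ∪ ⁅ v ⁆)) × n ≤ ∣ S ∪ ⁅ v ⁆ ∣ + f
  legal-step {S} {v} {f} n≤ t with v∉S , encl ← legal⇒ G t = encl , (begin
    n                      ≤⟨ n≤ ⟩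
    ∣ S ∣ + suc f           ≡⟨ +-suc ∣ S ∣ f ⟩
    suc ∣ S ∣ + f           ≤⟨ +-monoˡ-≤ f (p⊂q⇒∣p∣<∣q∣ S⊂S∪v) ⟩
    ∣ S ∪ ⁅ v ⁆ ∣ + f       ∎)
    where
    open ≤-Reasoning
    S⊂S∪v : S ⊂ S ∪ ⁅ v ⁆
    S⊂S∪v = p⊆p∪q ⁅ v ⁆ , v , x∈p∪q⁺ (inj₂ (x∈⁅x⁆ v)) , v∉S

  value-attained : ∀ f p S → T (enclaveless G S) → n ≤ ∣ S ∣ + f → Attained (value G f p S)
  value-attained zero p S encl n≤ =
    S , (encl , full⇒terminal {S} (subst (n ≤_) (+-identityʳ ∣ S ∣) n≤)) , refl
  value-attained (suc f) p S encl n≤ with legalMoves G S in moves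
  ... | [] = S , (encl , λ v t → case subst (v ∈ₗ_) moves (legalMoves⁺ {S} t) of λ ()) , refl
  ... | v ∷ vs with p
  ...   | Maximizer = foldr-selective-preserves {P = Attained} ⊔-sel
                        (λ w → value G f Minimizer (S ∪ ⁅ w ⁆)) v vs λ w w∈ →
          let encl′ , n≤′ = legal-step {S} n≤ (legalMoves⁻ {S} (subst (w ∈ₗ_) (sym moves) w∈))
          in value-attained f Minimizer (S ∪ ⁅ w ⁆) encl′ n≤′
  ...   | Minimizer = foldr-selective-preserves {P = Attained} ⊓-sel
                        (λ w → value G f Maximizer (S ∪ ⁅ w ⁆)) v vs λ w w∈ →
          let encl′ , n≤′ = legal-step {S} n≤ (legalMoves⁻ {S} (subst (w ∈ₗ_) (sym moves) w∈))
          in value-attained f Maximizer (S ∪ ⁅ w ⁆) encl′ n≤′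

  game-value-attained : ∀ p → Attained (value G n p ⊥)
  game-value-attained p = value-attained n p ⊥ ⊥-enclaveless (m≤n+m n ∣ ⊥ {n} ∣)
    where
    ⊥-enclaveless : T (enclaveless G ⊥)
    ⊥-enclaveless = T-enclaveless⇔noEnclave G .from λ v (v∈⊥ , _) → ∉⊥ v∈⊥

proposition4p2 : (k n : ℕ) → 1 ≤ k → (G : Graph n) →
    MinDegreeAtLeast G k → ¬ HasInducedStar G (suc k) →
    (n ≤ 2 * Ψg⁺ G) × (n ≤ 2 * Ψg⁻ G)
proposition4p2 k n 1≤k G δ≥k noStar = half≤ Maximizer , half≤ Minimizer
  where
  half≤ : ∀ p → n ≤ 2 * value G n p ⊥
  half≤ p with S , maximal , value≡ ← game-value-attained G p =
    subst (λ x → n ≤ 2 * x) (sym value≡) (maximalEnclaveless⇒n≤2∣S∣ G {S} 1≤k δ≥k noStar maximal)
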